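{- Let $l\ge 2$ be an integer and let $m_1\ge 0$, $m_2\ge 0$ be integers with $m=m_1+m_2\ge 2l+1$ and $m_2\ge l-2$. Let $G''=T\vee F''$, where $T=K_l$ and $F''$ is obtained from the disjoint union $L_1\cup\dots\cup L_m$, in which $L_1,\dots,L_{m_1}$ are copies of $L^{(1)}$ and $L_{m_1+1},\dots,L_m$ are copies of $L^{(2)}$, by adding all possible edges between pairs of vertices in $\{x_1,\dots,x_m,y_1,\dots,y_m\}$, where $x_i,y_i$ are the vertices of $L_i$ corresponding to the distinguished vertices $x,y$. Then $\tau(G'')=\dfrac{l+3m_2}{2m_2+1}$.
   Context: All graphs are finite and simple. For $S\subseteq V(G)$, $G\setminus S$ is the subgraph induced on $V(G)\setminus S$ and $\omega(\cdot)$ is the number of components. The toughness $\tau(G)$ is the minimum of $|S|/\omega(G\setminus S)$ over all $S\subseteq V(G)$ with $\omega(G\setminus S)>1$ ($\tau(K_n)=\infty$). $A\vee B$ denotes the join (disjoint union plus all edges between $V(A)$ and $V(B)$). $L^{(1)}$ is the graph obtained from the $8$-cycle $w_1w_2\cdots w_8w_1$ by adding the edges $w_2w_4,w_4w_6,w_6w_8,w_2w_8$. $L^{(2)}$ is obtained from $L^{(1)}$ by deleting the edges $w_1w_2$, $w_2w_8$ and identifying $w_2$ with $w_8$. In both $L^{(1)}$ and $L^{(2)}$ the distinguished vertices are $x=w_1$ and $y=w_5$. -}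

module Defs where

open import Data.Nat using (ℕ; zero; suc; _+_; _*_; _≡ᵇ_; _<_; _≤_)
open import Data.Bool using (Bool; true; false; _∧_; _∨_; not; T)
open import Data.Fin using (Fin; toℕ; splitAt; remQuot)
open import Data.Fin.Subset using (Subset; _∈_; _∉_; ∣_∣)
open import Data.List using (List; []; _∷_)
open import Data.Bool.ListAction using (any)
open import Data.Product using (_×_; _,_; ∃; Σ)
open import Data.Sum using (_⊎_; inj₁; inj₂)
open import Relation.Binary.PropositionalEquality using (_≡_)

data Reach {n : ℕ} (E : Fin n → Fin n → Set) (S : Subset n) (u : Fin n) : Fin n → Set where
  here : u ∉ S → Reach E S u u
  step : ∀ {v w} → Reach E S u v → E v w → w ∉ S → Reach E S u w

-- Components E S k : G \ S has exactly k connected components, witnessed by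
-- a labelling c of the vertices of G \ S by Fin k such that every label is
-- used, adjacent vertices get the same label, and vertices with the same
-- label are connected in G \ S  (i.e. the label classes are exactly the
-- connected components).
Components : {n : ℕ} → (Fin n → Fin n → Set) → Subset n → ℕ → Set
Components {n} E S k =
  Σ (Fin n → Fin k) λ c →
    ((i : Fin k) → ∃ λ v → v ∉ S × c v ≡ i) ×
    ((u v : Fin n) → u ∉ S → v ∉ S → E u v → c u ≡ c v) ×
    ((u v : Fin n) → u ∉ S → v ∉ S → c u ≡ c v → Reach E S u v)

-- ToughnessEq E p q : τ(G) = p / q, i.e. p/q is the minimum of |S|/ω(G\S)
-- over all S with ω(G \ S) > 1 (cross-multiplied; q > 0).  The existence
-- clause in particular forces G to be non-complete (τ finite).
ToughnessEq : {n : ℕ} → (Fin n → Fin n → Set) → ℕ → ℕ → Set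
ToughnessEq {n} E p q =
  ((S : Subset n) (k : ℕ) → Components E S k → 1 < k → p * k ≤ ∣ S ∣ * q) ×
  (∃ λ (S : Subset n) → ∃ λ (k : ℕ) → Components E S k × 1 < k × ∣ S ∣ * q ≡ p * k)

-- Vertices: T t  (vertex t of K_l),
--           A i j (vertex w_{j+1} of the i-th copy of L^(1), j = 0..7),
--           B i j (j-th vertex of the i-th copy of L^(2), with labelling
--                  0 = w1, 1 = w2 (= w8), 2 = w3, 3 = w4, 4 = w5, 5 = w6, 6 = w7).
data Vtx (l m₁ m₂ : ℕ) : Set where
  T' : Fin l → Vtx l m₁ m₂
  A  : Fin m₁ → Fin 8 → Vtx l m₁ m₂
  B  : Fin m₂ → Fin 7 → Vtx l m₁ m₂

memPair : ℕ → ℕ → List (ℕ × ℕ) → Bool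
memPair a b = any (λ { (c , d) → ((a ≡ᵇ c) ∧ (b ≡ᵇ d)) ∨ ((a ≡ᵇ d) ∧ (b ≡ᵇ c)) })

-- L^(1): 8-cycle w1..w8 (indices 0..7) plus w2w4, w4w6, w6w8, w2w8.
edgesL1 : List (ℕ × ℕ)
edgesL1 = (0 , 1) ∷ (1 , 2) ∷ (2 , 3) ∷ (3 , 4) ∷ (4 , 5) ∷ (5 , 6) ∷ (6 , 7) ∷ (7 , 0)
        ∷ (1 , 3) ∷ (3 , 5) ∷ (5 , 7) ∷ (1 , 7) ∷ []

-- L^(2): delete w1w2, w2w8 from L^(1), identify w8 with w2.  Remaining
-- edges w2w3,w3w4,w4w5,w5w6,w6w7,w7w8,w8w1,w2w4,w4w6,w6w8 become (in the
-- 7-vertex labelling above):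
edgesL2 : List (ℕ × ℕ)
edgesL2 = (1 , 2) ∷ (2 , 3) ∷ (3 , 4) ∷ (4 , 5) ∷ (5 , 6) ∷ (6 , 1) ∷ (1 , 0)
        ∷ (1 , 3) ∷ (3 , 5) ∷ (5 , 1) ∷ []

-- distinguished vertices x = w1 (index 0) and y = w5 (index 4) in both.
isXY : ℕ → Bool
isXY j = (j ≡ᵇ 0) ∨ (j ≡ᵇ 4)

isDist : ∀ {l m₁ m₂} → Vtx l m₁ m₂ → Bool
isDist (T' _)  = false
isDist (A _ j) = isXY (toℕ j)
isDist (B _ j) = isXY (toℕ j)

vEq : ∀ {l m₁ m₂} → Vtx l m₁ m₂ → Vtx l m₁ m₂ → Bool
vEq (T' s) (T' t) = toℕ s ≡ᵇ toℕ t
vEq (A i j) (A i' j') = (toℕ i ≡ᵇ toℕ i') ∧ (toℕ j ≡ᵇ toℕ j')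
vEq (B i j) (B i' j') = (toℕ i ≡ᵇ toℕ i') ∧ (toℕ j ≡ᵇ toℕ j')
vEq _ _ = false

copyEdge : ∀ {l m₁ m₂} → Vtx l m₁ m₂ → Vtx l m₁ m₂ → Bool
copyEdge (A i j) (A i' j') = (toℕ i ≡ᵇ toℕ i') ∧ memPair (toℕ j) (toℕ j') edgesL1
copyEdge (B i j) (B i' j') = (toℕ i ≡ᵇ toℕ i') ∧ memPair (toℕ j) (toℕ j') edgesL2
copyEdge _ _ = false

isT : ∀ {l m₁ m₂} → Vtx l m₁ m₂ → Bool
isT (T' _) = true
isT _      = false

edgeV : ∀ {l m₁ m₂} → Vtx l m₁ m₂ → Vtx l m₁ m₂ → Bool
edgeV u v =
  not (vEq u v) ∧
  (  isT u ∨ isT v                      -- K_l is complete, and the join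
   ∨ (isDist u ∧ isDist v)
   ∨ copyEdge u v)

order : ℕ → ℕ → ℕ → ℕ
order l m₁ m₂ = l + (m₁ * 8 + m₂ * 7)

decode : ∀ l m₁ m₂ → Fin (order l m₁ m₂) → Vtx l m₁ m₂
decode l m₁ m₂ v with splitAt l v
... | inj₁ t = T' t
... | inj₂ w with splitAt (m₁ * 8) w
...   | inj₁ a with remQuot {m₁} 8 a
...     | (i , j) = A i j
decode l m₁ m₂ v | inj₂ w | inj₂ b with remQuot {m₂} 7 b
...     | (i , j) = B i j

G'' : ∀ l m₁ m₂ → Fin (order l m₁ m₂) → Fin (order l m₁ m₂) → Set
G'' l m₁ m₂ u v = T (edgeV (decode l m₁ m₂ u) (decode l m₁ m₂ v))

-- Deleting K_l together with w₂, w₄, w₆ of every copy of L⁽²⁾ isolates w₃ and w₇ of each such copy,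
-- while every other surviving vertex stays joined to the clique on the x's and y's: 2m₂ + 1 components
-- for l + 3m₂ deleted vertices (if m₂ = 0, so that l = 2, cut the copies of L⁽¹⁾ instead).
--
-- Conversely, a disconnecting set S contains the universal vertices of K_l.  A component of G'' − S
-- either contains a surviving distinguished vertex (these form a clique, so there is at most one such
-- component) or lies inside one copy and avoids its x and y.  An exhaustive check over all deletion
-- patterns shows that deleting s vertices of L⁽¹⁾ leaves at most s/2 components avoiding x and y; the
-- same holds for L⁽²⁾, except for patterns with s ≥ 3, at most 2 such components and x or y surviving.
-- Charging p = l + 3m₂ per component and q = 2m₂ + 1 per deleted vertex, every regular copy pays for
-- its components and every exceptional one overdraws by at most 2p − 3q = 2l − 3.  Exceptional copies
-- force the clique component to exist, and that component together with at most m₂ overdrafts is paid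
-- for by the l deleted vertices of K_l, because p + (2l − 3) m₂ = q l.

module Submission where

open import Defs
open import Data.Nat using (ℕ; zero; suc; _+_; _*_; _%_; _≤_; _<_; z≤n; s≤s; _≡ᵇ_; _<ᵇ_; _≤?_)
open import Data.Nat.Properties
  using ( module ≤-Reasoning; ≤-trans; ≤-reflexive; n≤1+n; m≤n+m; +-assoc; *-identityʳ; *-zeroʳ
        ; *-distribˡ-+; +-mono-≤; +-monoˡ-≤; +-monoʳ-≤; *-monoˡ-≤; *-monoʳ-≤; +-cancelʳ-≤
        ; m≤n⇒∃[o]m+o≡n; ≡ᵇ⇒≡; ≡⇒≡ᵇ; +-*-semiring )
open import Data.Nat.Tactic.RingSolver using (solve)
open import Algebra.Properties.Semiring.Sum +-*-semiring
  using (sum; sum-cong-≗; sum-remove; ∑-distrib-+; *-distribˡ-sum)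
open import Data.Bool using (Bool; true; false; T; not; _∧_; _∨_; if_then_else_)
open import Data.Bool.ListAction using (any)
open import Data.Bool.Properties using (∧-comm; ∨-comm; T-∧; T?)
open import Data.Fin using (Fin; zero; suc; toℕ; _↑ˡ_; _↑ʳ_; combine; splitAt; join; punchIn; punchOut; _≟_)
open import Data.Fin.Properties
  using ( all?; toℕ-injective; suc-injective; punchOut-injective; punchIn-punchOut
        ; splitAt-↑ˡ; splitAt-↑ʳ; join-splitAt; remQuot-combine; combine-remQuot )
open import Data.Fin.Patterns using (0F; 1F; 2F; 3F; 4F; 5F; 6F; 7F)
open import Data.Fin.Subset using (Subset; _∈_; _∉_; ∣_∣; ⊥)
open import Data.Fin.Subset.Properties using (_∈?_; anySubset?; ∉⊥)
open import Data.Vec as Vec using (Vec; lookup)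
open import Data.Vec.Properties using ([]=⇒lookup; lookup⇒[]=; lookup∘tabulate; lookup-allFin)
open import Data.List as List using (List; []; _∷_)
open import Data.List.Properties using (foldr-preservesʳ)
open import Data.List.Membership.Propositional.Properties using (∈-allFin)
import Data.List.Relation.Unary.Any as Any
open import Data.List.Relation.Unary.Any.Properties using (any⁺; any⁻)
open import Data.Sum using (_⊎_; inj₁; inj₂; [_,_]′)
open import Data.Maybe using (Maybe; just; nothing; maybe)
open import Data.Product using (∃; _×_; _,_; proj₁; proj₂)
open import Data.Empty using (⊥-elim)
open import Function using (_∘_; id; Injective; Equivalence)
open import Relation.Nullary using (¬_; Dec; yes; no; ¬?; _⊎-dec_; _×-dec_)
open import Relation.Nullary.Decidable using (False; toWitness; toWitnessFalse; decidable-stable; _→-dec_)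
open import Relation.Unary using (Decidable)
open import Relation.Binary.PropositionalEquality

iverson : Bool → ℕ
iverson true  = 1
iverson false = 0

iverson≤1 : ∀ b → iverson b ≤ 1
iverson≤1 true  = s≤s z≤n
iverson≤1 false = z≤n

T⇒iverson≡1 : ∀ {b} → T b → iverson b ≡ 1
T⇒iverson≡1 {true} _ = refl

T-∨ˡ : ∀ {a} b → T a → T (a ∨ b)
T-∨ˡ {true} _ _ = _

T-∨ʳ : ∀ a {b} → T b → T (a ∨ b)
T-∨ʳ true  _  = _
T-∨ʳ false tb = tb

≡ᵇ-refl : ∀ a → (a ≡ᵇ a) ≡ true
≡ᵇ-refl zero    = refl
≡ᵇ-refl (suc a) = ≡ᵇ-refl a

≡ᵇ-sym : ∀ a b → (a ≡ᵇ b) ≡ (b ≡ᵇ a)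
≡ᵇ-sym zero    zero    = refl
≡ᵇ-sym zero    (suc b) = refl
≡ᵇ-sym (suc a) zero    = refl
≡ᵇ-sym (suc a) (suc b) = ≡ᵇ-sym a b

∉⇒T-not : ∀ {n} {S : Subset n} {v} → v ∉ S → T (not (lookup S v))
∉⇒T-not {S = S} {v} v∉S with lookup S v in eq
... | true  = v∉S (lookup⇒[]= v S eq)
... | false = _

T-not⇒∉ : ∀ {n} {S : Subset n} {v} → T (not (lookup S v)) → v ∉ S
T-not⇒∉ {S = S} {v} survives v∈S rewrite []=⇒lookup v∈S = survives

restrict : ∀ {n k} → Subset n → (Fin k → Fin n) → Subset k
restrict S f = Vec.tabulate (lookup S ∘ f)

∉-restrict⁺ : ∀ {n k} {S : Subset n} (f : Fin k → Fin n) {a} → f a ∉ S → a ∉ restrict S f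
∉-restrict⁺ {S = S} f {a} =
  T-not⇒∉ ∘ subst (T ∘ not) (sym (lookup∘tabulate (lookup S ∘ f) a)) ∘ ∉⇒T-not

∉-restrict⁻ : ∀ {n k} {S : Subset n} (f : Fin k → Fin n) {a} → a ∉ restrict S f → f a ∉ S
∉-restrict⁻ {S = S} f {a} =
  T-not⇒∉ ∘ subst (T ∘ not) (lookup∘tabulate (lookup S ∘ f) a) ∘ ∉⇒T-not

everySubset : ∀ {n} {Q : Subset n → Set} (Q? : Decidable Q) → False (anySubset? (¬? ∘ Q?)) → ∀ P → Q P
everySubset Q? none P = decidable-stable (Q? P) (λ ¬QP → toWitnessFalse none (P , ¬QP))

splitAt⇒join : ∀ m {n} {v : Fin (m + n)} {x} → splitAt m v ≡ x → join m n x ≡ v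
splitAt⇒join m split = trans (cong (join m _) (sym split)) (join-splitAt m _ _)

-- Finite sums and counting

count : ∀ {n} → (Fin n → Bool) → ℕ
count p = sum (iverson ∘ p)

sum-↑ : ∀ m {n} (f : Fin (m + n) → ℕ) → sum f ≡ sum (f ∘ (_↑ˡ n)) + sum (f ∘ (m ↑ʳ_))
sum-↑ zero    f = refl
sum-↑ (suc m) f = trans (cong (f zero +_) (sum-↑ m (f ∘ suc))) (sym (+-assoc (f zero) _ _))

sum-combine : ∀ m {n} (f : Fin (m * n) → ℕ) → sum f ≡ sum (λ i → sum (λ j → f (combine {m} {n} i j)))
sum-combine zero    f = refl
sum-combine (suc m) {n} f =
  trans (sum-↑ n f) (cong (sum (f ∘ (_↑ˡ m * n)) +_) (sum-combine m (f ∘ (n ↑ʳ_))))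

sum-mono-≤ : ∀ {n} {f g : Fin n → ℕ} → (∀ i → f i ≤ g i) → sum f ≤ sum g
sum-mono-≤ {zero}  f≤g = z≤n
sum-mono-≤ {suc n} f≤g = +-mono-≤ (f≤g zero) (sum-mono-≤ (f≤g ∘ suc))

sum-const : ∀ n c → sum {n} (λ _ → c) ≡ n * c
sum-const zero    c = refl
sum-const (suc n) c = cong (c +_) (sum-const n c)

∣∣≡count : ∀ {n} (P : Subset n) → ∣ P ∣ ≡ count (lookup P)
∣∣≡count Vec.[]           = refl
∣∣≡count (true  Vec.∷ P) = cong suc (∣∣≡count P)
∣∣≡count (false Vec.∷ P) = ∣∣≡count P

sum-scaled-≤ : ∀ {n a b} (f g : Fin n → ℕ) → (∀ i → a * f i ≤ b * g i) → a * sum f ≤ b * sum g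
sum-scaled-≤ {a = a} {b} f g h = begin
  a * sum f              ≡⟨ *-distribˡ-sum a f ⟩
  sum (λ i → a * f i)    ≤⟨ sum-mono-≤ h ⟩
  sum (λ i → b * g i)    ≡⟨ sym (*-distribˡ-sum b g) ⟩
  b * sum g              ∎
  where open ≤-Reasoning

sum-linear : ∀ {n} a b (f g : Fin n → ℕ) → sum (λ i → a * f i + b * g i) ≡ a * sum f + b * sum g
sum-linear a b f g = trans (∑-distrib-+ (λ i → a * f i) (λ i → b * g i))
                           (sym (cong₂ _+_ (*-distribˡ-sum a f) (*-distribˡ-sum b g)))

sum-scaled₂-≤ : ∀ {n a b c d} (f g h e : Fin n → ℕ) → (∀ i → a * f i + b * g i ≤ c * h i + d * e i) →
                a * sum f + b * sum g ≤ c * sum h + d * sum e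
sum-scaled₂-≤ {a = a} {b} {c} {d} f g h e bound =
  subst₂ _≤_ (sum-linear a b f g) (sum-linear c d h e) (sum-mono-≤ bound)

injective⇒≤count : ∀ {k N} (p : Fin N → Bool) (g : Fin k → Fin N) →
                   Injective _≡_ _≡_ g → (∀ i → T (p (g i))) → k ≤ count p
injective⇒≤count {zero}          p g inj pg = z≤n
injective⇒≤count {suc k} {zero}  p g inj pg with g zero
... | ()
injective⇒≤count {suc k} {suc N} p g inj pg = begin
  suc k                            ≤⟨ s≤s (injective⇒≤count p′ g′ g′-injective g′∈p′) ⟩
  1 + count p′                     ≡⟨ cong (_+ count p′) (sym (T⇒iverson≡1 (pg zero))) ⟩
  iverson (p (g zero)) + count p′  ≡⟨ sym (sum-remove (iverson ∘ p)) ⟩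
  count p                          ∎
  where
    open ≤-Reasoning
    p′ = p ∘ punchIn (g zero)
    g0≢g : ∀ i → g zero ≢ g (suc i)
    g0≢g i eq with inj eq
    ... | ()
    g′ : Fin k → Fin N
    g′ i = punchOut (g0≢g i)
    g′-injective : Injective _≡_ _≡_ g′
    g′-injective eq = suc-injective (inj (punchOut-injective (g0≢g _) (g0≢g _) eq))
    g′∈p′ : ∀ i → T (p′ (g′ i))
    g′∈p′ i rewrite punchIn-punchOut (g0≢g i) = pg (suc i)

-- Walks and components

Reach-map : ∀ {n n′} {E : Fin n → Fin n → Set} {E′ : Fin n′ → Fin n′ → Set}
              {P : Subset n} {S : Subset n′} (f : Fin n → Fin n′) →
            (∀ {a b} → E a b → E′ (f a) (f b)) → (∀ {a} → a ∉ P → f a ∉ S) →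
            ∀ {u v} → Reach E P u v → Reach E′ S (f u) (f v)
Reach-map f f-edge f-∉ (here u∉P)     = here (f-∉ u∉P)
Reach-map f f-edge f-∉ (step r e v∉P) = step (Reach-map f f-edge f-∉ r) (f-edge e) (f-∉ v∉P)

module _ {n : ℕ} {E : Fin n → Fin n → Set} {S : Subset n} where

  Reach-target : ∀ {u v} → Reach E S u v → v ∉ S
  Reach-target (here v∉S)     = v∉S
  Reach-target (step _ _ v∉S) = v∉S

  Reach-trans : ∀ {u v w} → Reach E S u v → Reach E S v w → Reach E S u w
  Reach-trans r (here _)        = r
  Reach-trans r (step r′ e w∉S) = step (Reach-trans r r′) e w∉S

  edge⇒Reach : ∀ {u v} → u ∉ S → E u v → v ∉ S → Reach E S u v
  edge⇒Reach u∉S e v∉S = step (here u∉S) e v∉S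

  Reach-sym : (∀ {a b} → E a b → E b a) → ∀ {u v} → Reach E S u v → Reach E S v u
  Reach-sym E-sym (here u∉S)     = here u∉S
  Reach-sym E-sym (step r e w∉S) =
    Reach-trans (edge⇒Reach w∉S (E-sym e) (Reach-target r)) (Reach-sym E-sym r)

  Reach⇒sameComponent : ∀ {k} ((label , _ , respects , _) : Components E S k) →
                        ∀ {u v} → Reach E S u v → label u ≡ label v
  Reach⇒sameComponent comp (here _)       = refl
  Reach⇒sameComponent comp@(_ , _ , respects , _) (step r e v∉S) =
    trans (Reach⇒sameComponent comp r) (respects _ _ (Reach-target r) v∉S e)

  universal∈separator : ∀ {k} → Components E S k → 1 < k → ∀ t → (∀ v → v ≢ t → E v t) → t ∈ S
  universal∈separator (label , onto , respects , _) (s≤s (s≤s _)) t universal with t ∈? S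
  ... | yes t∈S = t∈S
  ... | no  t∉S = ⊥-elim (0≢1 (trans (labelOfT zero) (sym (labelOfT (suc zero)))))
    where
      0≢1 : ∀ {k} → _≢_ {A = Fin (suc (suc k))} zero (suc zero)
      0≢1 ()
      labelOfT : ∀ i → i ≡ label t
      labelOfT i with onto i
      ... | v , v∉S , refl with v ≟ t
      ...   | yes refl = refl
      ...   | no v≢t   = respects v t v∉S t∉S (universal v v≢t)

  components≤count : ∀ {k N} → Components E S k → (slot : Fin n → Fin N) (active : Fin N → Bool) →
                     (∀ v → v ∉ S → T (active (slot v))) →
                     (∀ u v → u ∉ S → v ∉ S → slot u ≡ slot v → Reach E S u v) →
                     k ≤ count active
  components≤count comp@(label , onto , _) slot active slot-active slot-reach =
    injective⇒≤count active (slot ∘ rep) rep-injective (λ i → slot-active (rep i) (rep∉S i))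
    where
      rep = λ i → proj₁ (onto i)
      rep∉S = λ i → proj₁ (proj₂ (onto i))
      rep-injective : Injective _≡_ _≡_ (slot ∘ rep)
      rep-injective {i} {j} same =
        trans (sym (proj₂ (proj₂ (onto i))))
              (trans (Reach⇒sameComponent comp (slot-reach _ _ (rep∉S i) (rep∉S j) same))
                     (proj₂ (proj₂ (onto j))))

  hubAndIsolated-components :
    (∀ {a b} → E a b → E b a) →
    ∀ {N} (isolated : Fin N → Fin n) (index : Fin n → Maybe (Fin N)) →
    (∀ i → index (isolated i) ≡ just i) → (∀ v {i} → index v ≡ just i → v ≡ isolated i) →
    (∀ i → isolated i ∉ S) → (∀ i v → v ∉ S → ¬ E (isolated i) v) →
    ∀ hub → hub ∉ S → index hub ≡ nothing → (∀ v → v ∉ S → index v ≡ nothing → Reach E S hub v) →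
    Components E S (suc N)
  hubAndIsolated-components E-sym {N} isolated index index-isolated index⇒isolated
                            isolated∉S isolated-alone hub hub∉S index-hub hub-reach =
    label , onto , respects , connected
    where
      label : Fin n → Fin (suc N)
      label v = maybe suc zero (index v)
      onto : ∀ i → ∃ λ v → v ∉ S × label v ≡ i
      onto zero    = hub , hub∉S , cong (maybe suc zero) index-hub
      onto (suc i) = isolated i , isolated∉S i , cong (maybe suc zero) (index-isolated i)
      respects : ∀ u v → u ∉ S → v ∉ S → E u v → label u ≡ label v
      respects u v u∉S v∉S e with index u in eu | index v in ev
      ... | just i  | _      = ⊥-elim (isolated-alone i v v∉S (subst (λ w → E w v) (index⇒isolated u eu) e))
      ... | nothing | just j =
        ⊥-elim (isolated-alone j u u∉S (subst (λ w → E w u) (index⇒isolated v ev) (E-sym e)))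
      ... | nothing | nothing = refl
      connected : ∀ u v → u ∉ S → v ∉ S → label u ≡ label v → Reach E S u v
      connected u v u∉S v∉S same with index u in eu | index v in ev
      ... | nothing | nothing = Reach-trans (Reach-sym E-sym (hub-reach u u∉S eu)) (hub-reach v v∉S ev)
      ... | just i  | just j
        rewrite index⇒isolated u eu | index⇒isolated v ev | suc-injective same = here (isolated∉S j)

-- The gadgets L⁽¹⁾ and L⁽²⁾

memPair-sym : ∀ a b es → memPair a b es ≡ memPair b a es
memPair-sym a b []             = refl
memPair-sym a b ((c , d) ∷ es) = cong₂ _∨_
  (trans (cong₂ _∨_ (∧-comm (a ≡ᵇ c) (b ≡ᵇ d)) (∧-comm (a ≡ᵇ d) (b ≡ᵇ c)))
         (∨-comm ((b ≡ᵇ d) ∧ (a ≡ᵇ c)) _))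
  (memPair-sym a b es)

module Gadget {k : ℕ} (edges : List (ℕ × ℕ)) where

  adjacent : Fin k → Fin k → Bool
  adjacent a b = not (toℕ a ≡ᵇ toℕ b) ∧ memPair (toℕ a) (toℕ b) edges

  Adjacent : Fin k → Fin k → Set
  Adjacent a b = T (adjacent a b)

  Adjacent-sym : ∀ {a b} → Adjacent a b → Adjacent b a
  Adjacent-sym {a} {b} =
    subst T (cong₂ _∧_ (cong not (≡ᵇ-sym (toℕ a) (toℕ b))) (memPair-sym (toℕ a) (toℕ b) edges))

  terminal : Fin k → Bool
  terminal a = isXY (toℕ a)

  terminalSurvives : Subset k → Bool
  terminalSurvives P = any (λ t → terminal t ∧ not (lookup P t)) (List.allFin k)

  terminalSurvives⇒∃ : ∀ {P} → T (terminalSurvives P) → ∃ λ t → T (terminal t) × t ∉ P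
  terminalSurvives⇒∃ {P} survives with Any.satisfied (any⁻ _ (List.allFin k) survives)
  ... | t , t-survives with Equivalence.to T-∧ t-survives
  ...   | t-terminal , t∉P = t , t-terminal , T-not⇒∉ t∉P

  -- Label propagation on L − P: in each round every surviving vertex adopts the label of least
  -- priority among its own and those of its surviving neighbours.  Only soundness (a vertex reaches
  -- its label) is proved; the exhaustive checks below succeed because after k rounds the labels are
  -- the priority minima of the components, so a component containing a surviving terminal is
  -- labelled by one and freeRoots P counts the components of L − P avoiding x and y.
  priority : Fin k → ℕ
  priority a = (if terminal a then 0 else k) + toℕ a

  improve : Subset k → Vec (Fin k) k → Fin k → Fin k → Fin k → Fin k
  improve P ρ j b current =
    if not (lookup P b) ∧ (priority (lookup ρ b) <ᵇ priority current) ∧ adjacent j b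
    then lookup ρ b else current

  relax : Subset k → Vec (Fin k) k → Fin k → Fin k
  relax P ρ j = List.foldr (improve P ρ j) (lookup ρ j) (List.allFin k)

  labels : Subset k → ℕ → Vec (Fin k) k
  labels P zero    = Vec.allFin k
  labels P (suc t) = Vec.tabulate (relax P (labels P t))

  -- Opaque, so that unification never evaluates the propagation on a symbolic pattern.
  opaque
    roots : Subset k → Vec (Fin k) k
    roots P = labels P k

  root : Subset k → Fin k → Fin k
  root P = lookup (roots P)

  isRoot : Subset k → Vec (Fin k) k → Fin k → Bool
  isRoot P ρ a = any (λ b → not (lookup P b) ∧ (toℕ (lookup ρ b) ≡ᵇ toℕ a)) (List.allFin k)

  freeRoots : Subset k → ℕ
  freeRoots P = count (λ a → not (terminal a) ∧ isRoot P (roots P) a)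

  relax-reach : ∀ {P ρ j} → j ∉ P → (∀ b → b ∉ P → Reach Adjacent P b (lookup ρ b)) →
                Reach Adjacent P j (relax P ρ j)
  relax-reach {P} {ρ} {j} j∉P ρ-reach =
    foldr-preservesʳ {P = Reach Adjacent P j} improve-reach (ρ-reach j j∉P) (List.allFin k)
    where
      improve-reach : ∀ b {x} → Reach Adjacent P j x → Reach Adjacent P j (improve P ρ j b x)
      improve-reach b {x} r
        with not (lookup P b) ∧ (priority (lookup ρ b) <ᵇ priority x) ∧ adjacent j b in chosen
      ... | false = r
      ... | true with Equivalence.to (T-∧ {not (lookup P b)}) (subst T (sym chosen) _)
      ...   | b-survives , better-and-adjacent =
        Reach-trans (edge⇒Reach j∉P j~b (T-not⇒∉ b-survives)) (ρ-reach b (T-not⇒∉ b-survives))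
        where
          j~b = proj₂ (Equivalence.to (T-∧ {priority (lookup ρ b) <ᵇ priority x}) better-and-adjacent)

  labels-reach : ∀ {P} t {j} → j ∉ P → Reach Adjacent P j (lookup (labels P t) j)
  labels-reach zero {j} j∉P rewrite lookup-allFin j = here j∉P
  labels-reach {P} (suc t) {j} j∉P rewrite lookup∘tabulate (relax P (labels P t)) j =
    relax-reach {ρ = labels P t} j∉P (λ b → labels-reach t)

  opaque
    unfolding roots

    reaches-root : ∀ {P j} → j ∉ P → Reach Adjacent P j (root P j)
    reaches-root = labels-reach k

  root-isRoot : ∀ {P j} → j ∉ P → T (isRoot P (roots P) (root P j))
  root-isRoot {P} {j} j∉P = any⁺ _ (Any.map labelled-by-root (∈-allFin j))
    where
      labelled-by-root : ∀ {b} → j ≡ b → T (not (lookup P b) ∧ (toℕ (root P b) ≡ᵇ toℕ (root P j)))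
      labelled-by-root refl = Equivalence.from T-∧ (∉⇒T-not j∉P , ≡⇒≡ᵇ (toℕ (root P j)) _ refl)

  rooted⇒reachable : ∀ x → (∀ j → root ⊥ j ≡ x) → ∀ j → Reach Adjacent ⊥ x j
  rooted⇒reachable x rooted-at-x j =
    Reach-sym (λ {a} {b} → Adjacent-sym {a} {b}) (subst (Reach Adjacent ⊥ j) (rooted-at-x j) (reaches-root ∉⊥))

  NeighboursIn : (Fin k → Bool) → Fin k → Set
  NeighboursIn cut a = ∀ b → T (memPair (toℕ a) (toℕ b) edges) → T (cut b)

  neighboursIn? : ∀ cut a → Dec (NeighboursIn cut a)
  neighboursIn? cut a = all? (λ b → T? (memPair (toℕ a) (toℕ b) edges) →-dec T? (cut b))

module L¹ = Gadget {8} edgesL1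
module L² = Gadget {7} edgesL2

opaque
  unfolding Gadget.roots

  L¹-freeRoots-bound : ∀ P → 2 * L¹.freeRoots P ≤ ∣ P ∣
  L¹-freeRoots-bound = everySubset (λ P → 2 * L¹.freeRoots P ≤? ∣ P ∣) _

  L²-freeRoots-bound : ∀ P → 2 * L².freeRoots P ≤ ∣ P ∣
                     ⊎ (L².freeRoots P ≤ 2 × 3 ≤ ∣ P ∣ × T (L².terminalSurvives P))
  L²-freeRoots-bound = everySubset (λ P → (2 * L².freeRoots P ≤? ∣ P ∣)
                                           ⊎-dec ((L².freeRoots P ≤? 2) ×-dec (3 ≤? ∣ P ∣)
                                                                       ×-dec T? (L².terminalSurvives P))) _

  L¹-connected-from-x : ∀ j → Reach L¹.Adjacent ⊥ 0F j
  L¹-connected-from-x = L¹.rooted⇒reachable 0F (toWitness {a? = all? (λ j → L¹.root ⊥ j ≟ 0F)} _)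

  L²-connected-from-x : ∀ j → Reach L².Adjacent ⊥ 0F j
  L²-connected-from-x = L².rooted⇒reachable 0F (toWitness {a? = all? (λ j → L².root ⊥ j ≟ 0F)} _)

-- w₂, w₄, w₆, w₈ (with w₈ = w₂ in L⁽²⁾) are the vertices of odd index in the 0-based labelling of Defs
evenW : ∀ {k} → Fin k → Bool
evenW j = toℕ j % 2 ≡ᵇ 1

L¹-w₃-neighbours-even : L¹.NeighboursIn evenW 2F
L¹-w₃-neighbours-even = toWitness {a? = L¹.neighboursIn? evenW 2F} _

L¹-w₇-neighbours-even : L¹.NeighboursIn evenW 6F
L¹-w₇-neighbours-even = toWitness {a? = L¹.neighboursIn? evenW 6F} _

L²-w₃-neighbours-even : L².NeighboursIn evenW 2F
L²-w₃-neighbours-even = toWitness {a? = L².neighboursIn? evenW 2F} _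

L²-w₇-neighbours-even : L².NeighboursIn evenW 6F
L²-w₇-neighbours-even = toWitness {a? = L².neighboursIn? evenW 6F} _

3q≤2p : ∀ l m → 2 ≤ l → 3 * (2 * m + 1) ≤ 2 * (l + 3 * m)
3q≤2p l m 2≤l = begin
  3 * (2 * m + 1) ≡⟨ solve (m ∷ []) ⟩
  3 + 6 * m       ≤⟨ +-monoˡ-≤ (6 * m) (≤-trans (n≤1+n 3) (*-monoʳ-≤ 2 2≤l)) ⟩
  2 * l + 6 * m   ≡⟨ solve (l ∷ m ∷ []) ⟩
  2 * (l + 3 * m) ∎
  where open ≤-Reasoning

p≤2q : ∀ l m → l ≤ m + 2 → l + 3 * m ≤ 2 * (2 * m + 1)
p≤2q l m l≤m+2 = begin
  l + 3 * m         ≤⟨ +-monoˡ-≤ (3 * m) l≤m+2 ⟩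
  m + 2 + 3 * m     ≡⟨ solve (m ∷ []) ⟩
  2 * (2 * m + 1)   ∎
  where open ≤-Reasoning

-- With E = m both sides are p * q; lowering E by one lowers the left side by 2p but the right side only by 3q ≤ 2p.
exceptional-copies : ∀ l m E → 2 ≤ l → E ≤ m →
                     (l + 3 * m) * (1 + 2 * E) ≤ (2 * m + 1) * (l + 3 * E)
exceptional-copies l m E 2≤l E≤m with m≤n⇒∃[o]m+o≡n E≤m
... | d , refl = +-cancelʳ-≤ (3 * (2 * (E + d) + 1) * d) _ _ (begin
  (l + 3 * (E + d)) * (1 + 2 * E) + 3 * (2 * (E + d) + 1) * d
    ≤⟨ +-monoʳ-≤ ((l + 3 * (E + d)) * (1 + 2 * E)) (*-monoˡ-≤ d (3q≤2p l (E + d) 2≤l)) ⟩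
  (l + 3 * (E + d)) * (1 + 2 * E) + 2 * (l + 3 * (E + d)) * d
    ≡⟨ solve (l ∷ E ∷ d ∷ []) ⟩
  (2 * (E + d) + 1) * (l + 3 * E) + 3 * (2 * (E + d) + 1) * d ∎)
  where open ≤-Reasoning

bound-with-hub : ∀ p q l {E RA SA RB SB} → p * (1 + 2 * E) ≤ q * (l + 3 * E) →
                 p * RA ≤ q * SA → p * RB + 3 * q * E ≤ q * SB + 2 * p * E →
                 p * (1 + (RA + RB)) ≤ (l + (SA + SB)) * q
bound-with-hub p q l {E} {RA} {SA} {RB} {SB} hub hA hB = +-cancelʳ-≤ (3 * q * E) _ _ (begin
  p * (1 + (RA + RB)) + 3 * q * E       ≡⟨ solve (p ∷ q ∷ E ∷ RA ∷ RB ∷ []) ⟩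
  p + p * RA + (p * RB + 3 * q * E)     ≤⟨ +-mono-≤ (+-monoʳ-≤ p hA) hB ⟩
  p + q * SA + (q * SB + 2 * p * E)     ≡⟨ solve (p ∷ q ∷ E ∷ SA ∷ SB ∷ []) ⟩
  p * (1 + 2 * E) + q * (SA + SB)       ≤⟨ +-monoˡ-≤ (q * (SA + SB)) hub ⟩
  q * (l + 3 * E) + q * (SA + SB)       ≡⟨ solve (q ∷ l ∷ E ∷ SA ∷ SB ∷ []) ⟩
  (l + (SA + SB)) * q + 3 * q * E       ∎)
  where open ≤-Reasoning

bound-without-hub : ∀ p q l {E RA SA RB SB} → E ≡ 0 →
                    p * RA ≤ q * SA → p * RB + 3 * q * E ≤ q * SB + 2 * p * E →
                    p * (0 + (RA + RB)) ≤ (l + (SA + SB)) * q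
bound-without-hub p q l {_} {RA} {SA} {RB} {SB} refl hA hB = begin
  p * (RA + RB)            ≡⟨ *-distribˡ-+ p RA RB ⟩
  p * RA + p * RB          ≤⟨ +-mono-≤ hA (begin
                                p * RB                  ≡⟨ solve (p ∷ q ∷ RB ∷ []) ⟩
                                p * RB + 3 * q * 0      ≤⟨ hB ⟩
                                q * SB + 2 * p * 0      ≡⟨ solve (p ∷ q ∷ SB ∷ []) ⟩
                                q * SB                  ∎) ⟩
  q * SA + q * SB          ≤⟨ m≤n+m _ (q * l) ⟩
  q * l + (q * SA + q * SB) ≡⟨ solve (q ∷ l ∷ SA ∷ SB ∷ []) ⟩
  (l + (SA + SB)) * q      ∎
  where open ≤-Reasoning

half-bound : ∀ {p q r s} → p ≤ 2 * q → 2 * r ≤ s → p * r ≤ q * s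
half-bound {p} {q} {r} {s} p≤2q 2r≤s = begin
  p * r        ≤⟨ *-monoˡ-≤ r p≤2q ⟩
  2 * q * r    ≡⟨ solve (q ∷ r ∷ []) ⟩
  q * (2 * r)  ≤⟨ *-monoʳ-≤ q 2r≤s ⟩
  q * s        ∎
  where open ≤-Reasoning

exceptional-bound : ∀ {p q r s} → r ≤ 2 → 3 ≤ s → p * r + 3 * q * 1 ≤ q * s + 2 * p * 1
exceptional-bound {p} {q} {r} {s} r≤2 3≤s = begin
  p * r + 3 * q * 1  ≤⟨ +-mono-≤ (*-monoʳ-≤ p r≤2) (≤-reflexive (solve (q ∷ []))) ⟩
  p * 2 + q * 3      ≤⟨ +-monoʳ-≤ (p * 2) (*-monoʳ-≤ q 3≤s) ⟩
  p * 2 + q * s      ≡⟨ solve (p ∷ q ∷ s ∷ []) ⟩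
  q * s + 2 * p * 1  ∎
  where open ≤-Reasoning

L¹-weighted-bound : ∀ p q → p ≤ 2 * q → ∀ P → p * L¹.freeRoots P ≤ q * ∣ P ∣
L¹-weighted-bound p q p≤2q P = half-bound {p} {q} p≤2q (L¹-freeRoots-bound P)

L²-weighted-bound : ∀ p q → p ≤ 2 * q → 3 * q ≤ 2 * p → ∀ P →
               p * L².freeRoots P + 3 * q * iverson (L².terminalSurvives P)
                 ≤ q * ∣ P ∣ + 2 * p * iverson (L².terminalSurvives P)
L²-weighted-bound p q p≤2q 3q≤2p P = [ regular , exceptional ]′ (L²-freeRoots-bound P)
  where
    r = L².freeRoots P
    s = ∣ P ∣
    e = iverson (L².terminalSurvives P)
    regular : 2 * r ≤ s → p * r + 3 * q * e ≤ q * s + 2 * p * e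
    regular 2r≤s = +-mono-≤ (half-bound {p} {q} p≤2q 2r≤s) (*-monoˡ-≤ e 3q≤2p)
    exceptional : r ≤ 2 × 3 ≤ s × T (L².terminalSurvives P) → p * r + 3 * q * e ≤ q * s + 2 * p * e
    exceptional (r≤2 , 3≤s , survives) =
      subst (λ e → p * r + 3 * q * e ≤ q * s + 2 * p * e) (sym (T⇒iverson≡1 survives))
            (exceptional-bound {p} {q} r≤2 3≤s)

-- The graph G''

module _ {l m₁ m₂ : ℕ} where

  private
    V = Vtx l m₁ m₂
    G = G'' l m₁ m₂

  encode : Vtx l m₁ m₂ → Fin (order l m₁ m₂)
  encode (T' t)  = t ↑ˡ (m₁ * 8 + m₂ * 7)
  encode (A i j) = l ↑ʳ (combine i j ↑ˡ (m₂ * 7))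
  encode (B i j) = l ↑ʳ ((m₁ * 8) ↑ʳ combine i j)

  decode-encode : ∀ x → decode l m₁ m₂ (encode x) ≡ x
  decode-encode (T' t) rewrite splitAt-↑ˡ l t (m₁ * 8 + m₂ * 7) = refl
  decode-encode (A i j)
    rewrite splitAt-↑ʳ l (m₁ * 8 + m₂ * 7) (combine i j ↑ˡ (m₂ * 7))
          | splitAt-↑ˡ (m₁ * 8) (combine i j) (m₂ * 7)
          = cong (λ (i , j) → A i j) (remQuot-combine {m₁} {8} i j)
  decode-encode (B i j)
    rewrite splitAt-↑ʳ l (m₁ * 8 + m₂ * 7) ((m₁ * 8) ↑ʳ combine i j)
          | splitAt-↑ʳ (m₁ * 8) (m₂ * 7) (combine i j)
          = cong (λ (i , j) → B i j) (remQuot-combine {m₂} {7} i j)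

  encode-decode : ∀ v → encode (decode l m₁ m₂ v) ≡ v
  encode-decode v with splitAt l v in split₁
  ... | inj₁ t = splitAt⇒join l split₁
  ... | inj₂ w with splitAt (m₁ * 8) w in split₂
  ...   | inj₁ a = trans (cong (λ a → l ↑ʳ (a ↑ˡ (m₂ * 7))) (combine-remQuot {m₁} 8 a))
                         (trans (cong (l ↑ʳ_) (splitAt⇒join (m₁ * 8) split₂)) (splitAt⇒join l split₁))
  ...   | inj₂ b = trans (cong (λ b → l ↑ʳ ((m₁ * 8) ↑ʳ b)) (combine-remQuot {m₂} 7 b))
                         (trans (cong (l ↑ʳ_) (splitAt⇒join (m₁ * 8) split₂)) (splitAt⇒join l split₁))

  sum-decode : (f : Vtx l m₁ m₂ → ℕ) →
               sum (f ∘ decode l m₁ m₂) ≡ sum (λ t → f (T' t)) + (sum (λ i → sum (λ j → f (A i j)))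
                                                               + sum (λ i → sum (λ j → f (B i j))))
  sum-decode f =
    trans (sum-↑ l (f ∘ decode l m₁ m₂))
      (cong₂ _+_ (sum-cong-≗ (λ t → cong f (decode-encode (T' t))))
        (trans (sum-↑ (m₁ * 8) _)
          (cong₂ _+_ (trans (sum-combine m₁ _) (sum-cong-≗ λ i → sum-cong-≗ (cong f ∘ decode-encode ∘ A i)))
                     (trans (sum-combine m₂ _) (sum-cong-≗ λ i → sum-cong-≗ (cong f ∘ decode-encode ∘ B i))))))

  vEq-sym : (x y : V) → vEq x y ≡ vEq y x
  vEq-sym (T' s)  (T' t)    = ≡ᵇ-sym (toℕ s) (toℕ t)
  vEq-sym (A i j) (A i′ j′) = cong₂ _∧_ (≡ᵇ-sym (toℕ i) (toℕ i′)) (≡ᵇ-sym (toℕ j) (toℕ j′))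
  vEq-sym (B i j) (B i′ j′) = cong₂ _∧_ (≡ᵇ-sym (toℕ i) (toℕ i′)) (≡ᵇ-sym (toℕ j) (toℕ j′))
  vEq-sym (T' _)  (A _ _)   = refl
  vEq-sym (T' _)  (B _ _)   = refl
  vEq-sym (A _ _) (T' _)    = refl
  vEq-sym (A _ _) (B _ _)   = refl
  vEq-sym (B _ _) (T' _)    = refl
  vEq-sym (B _ _) (A _ _)   = refl

  copyEdge-sym : (x y : V) → copyEdge x y ≡ copyEdge y x
  copyEdge-sym (A i j) (A i′ j′) = cong₂ _∧_ (≡ᵇ-sym (toℕ i) (toℕ i′)) (memPair-sym (toℕ j) (toℕ j′) edgesL1)
  copyEdge-sym (B i j) (B i′ j′) = cong₂ _∧_ (≡ᵇ-sym (toℕ i) (toℕ i′)) (memPair-sym (toℕ j) (toℕ j′) edgesL2)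
  copyEdge-sym (T' _)  (T' _)    = refl
  copyEdge-sym (T' _)  (A _ _)   = refl
  copyEdge-sym (T' _)  (B _ _)   = refl
  copyEdge-sym (A _ _) (T' _)    = refl
  copyEdge-sym (A _ _) (B _ _)   = refl
  copyEdge-sym (B _ _) (T' _)    = refl
  copyEdge-sym (B _ _) (A _ _)   = refl

  edgeV-sym : (x y : V) → edgeV x y ≡ edgeV y x
  edgeV-sym x y rewrite vEq-sym x y | copyEdge-sym x y | ∧-comm (isDist x) (isDist y) with isT x | isT y
  ... | true  | true  = refl
  ... | true  | false = refl
  ... | false | true  = refl
  ... | false | false = refl

  vEq⇒≡ : (x y : V) → T (vEq x y) → x ≡ y
  vEq⇒≡ (T' s)  (T' t)    eq = cong T' (toℕ-injective (≡ᵇ⇒≡ _ _ eq))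
  vEq⇒≡ (A i j) (A i′ j′) eq with Equivalence.to T-∧ eq
  ... | eqᵢ , eqⱼ = cong₂ A (toℕ-injective (≡ᵇ⇒≡ _ _ eqᵢ)) (toℕ-injective (≡ᵇ⇒≡ _ _ eqⱼ))
  vEq⇒≡ (B i j) (B i′ j′) eq with Equivalence.to T-∧ eq
  ... | eqᵢ , eqⱼ = cong₂ B (toℕ-injective (≡ᵇ⇒≡ _ _ eqᵢ)) (toℕ-injective (≡ᵇ⇒≡ _ _ eqⱼ))

  edge-intro : {x y : V} → x ≢ y → T (isT x ∨ isT y ∨ (isDist x ∧ isDist y) ∨ copyEdge x y) → T (edgeV x y)
  edge-intro {x} {y} x≢y reason with vEq x y in eq
  ... | true  = ⊥-elim (x≢y (vEq⇒≡ x y (subst T (sym eq) _)))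
  ... | false = reason

  universal-edge : ∀ (x : V) t → x ≢ T' t → T (edgeV x (T' t))
  universal-edge x t x≢t = edge-intro x≢t (T-∨ʳ (isT x) _)

  distinguished-edge : {x y : V} → x ≢ y → T (isDist x) → T (isDist y) → T (edgeV x y)
  distinguished-edge {x} {y} x≢y dx dy =
    edge-intro x≢y (T-∨ʳ (isT x) (T-∨ʳ (isT y) (T-∨ˡ (copyEdge x y) (Equivalence.from T-∧ (dx , dy)))))

  G''-encode : ∀ {x y : V} → T (edgeV x y) → G (encode x) (encode y)
  G''-encode {x} {y} = subst₂ (λ x y → T (edgeV x y)) (sym (decode-encode x)) (sym (decode-encode y))

  G''-sym : ∀ {u v} → G u v → G v u
  G''-sym {u} {v} = subst T (edgeV-sym (decode l m₁ m₂ u) (decode l m₁ m₂ v))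

  A-edge : ∀ i {a b} → L¹.Adjacent a b → T (edgeV (A {l} {m₁} {m₂} i a) (A i b))
  A-edge i {a} {b} adj rewrite ≡ᵇ-refl (toℕ i) with Equivalence.to (T-∧ {not (toℕ a ≡ᵇ toℕ b)}) adj
  ... | a≢b , a~b = Equivalence.from T-∧ (a≢b , T-∨ʳ (isXY (toℕ a) ∧ isXY (toℕ b)) a~b)

  B-edge : ∀ i {a b} → L².Adjacent a b → T (edgeV (B {l} {m₁} {m₂} i a) (B i b))
  B-edge i {a} {b} adj rewrite ≡ᵇ-refl (toℕ i) with Equivalence.to (T-∧ {not (toℕ a ≡ᵇ toℕ b)}) adj
  ... | a≢b , a~b = Equivalence.from T-∧ (a≢b , T-∨ʳ (isXY (toℕ a) ∧ isXY (toℕ b)) a~b)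

  module _ {S : Subset (order l m₁ m₂)} where

    A-Reach : ∀ i {P : Subset 8} → (∀ {a} → a ∉ P → encode (A i a) ∉ S) →
              ∀ {a b} → Reach L¹.Adjacent P a b → Reach G S (encode (A i a)) (encode (A i b))
    A-Reach i = Reach-map (encode ∘ A i) (λ {a} {b} adj → G''-encode {x = A i a} {y = A i b} (A-edge i {a} {b} adj))

    B-Reach : ∀ i {P : Subset 7} → (∀ {a} → a ∉ P → encode (B i a) ∉ S) →
              ∀ {a b} → Reach L².Adjacent P a b → Reach G S (encode (B i a)) (encode (B i b))
    B-Reach i = Reach-map (encode ∘ B i) (λ {a} {b} adj → G''-encode {x = B i a} {y = B i b} (B-edge i {a} {b} adj))

    distinguished-Reach : ∀ (x y : V) → T (isDist x) → T (isDist y) → encode x ∉ S → encode y ∉ S →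
                          Reach G S (encode x) (encode y)
    distinguished-Reach x y dx dy x∉S y∉S with encode x ≟ encode y
    ... | yes eq = subst (Reach G S (encode x)) eq (here x∉S)
    ... | no  x≢y =
      edge⇒Reach x∉S (G''-encode {x = x} {y = y} (distinguished-edge {x = x} {y = y} (x≢y ∘ cong encode) dx dy)) y∉S

  module LowerBound (S : Subset (order l m₁ m₂)) where

    private
      n = order l m₁ m₂
      decodeV = decode l m₁ m₂

    deletedA : Fin m₁ → Subset 8
    deletedA i = restrict S (encode ∘ A i)

    deletedB : Fin m₂ → Subset 7
    deletedB i = restrict S (encode ∘ B i)

    rep : V → V
    rep (T' t)  = T' t
    rep (A i a) = A i (L¹.root (deletedA i) a)
    rep (B i a) = B i (L².root (deletedB i) a)

    reaches-rep : ∀ x → encode x ∉ S → Reach G S (encode x) (encode (rep x))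
    reaches-rep (T' t)  x∉S = here x∉S
    reaches-rep (A i a) x∉S =
      A-Reach i (∉-restrict⁻ (encode ∘ A i)) (L¹.reaches-root (∉-restrict⁺ (encode ∘ A i) x∉S))
    reaches-rep (B i a) x∉S =
      B-Reach i (∉-restrict⁻ (encode ∘ B i)) (L².reaches-root (∉-restrict⁺ (encode ∘ B i) x∉S))

    freeRoot : V → Bool
    freeRoot (T' _)  = false
    freeRoot (A i a) = not (L¹.terminal a) ∧ L¹.isRoot (deletedA i) (L¹.roots (deletedA i)) a
    freeRoot (B i a) = not (L².terminal a) ∧ L².isRoot (deletedB i) (L².roots (deletedB i)) a

    rep-freeRoot : (∀ t → encode (T' t) ∈ S) → ∀ x → encode x ∉ S →
                   T (not (isDist (rep x))) → T (freeRoot (rep x))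
    rep-freeRoot T⊆S (T' t) x∉S _ = ⊥-elim (x∉S (T⊆S t))
    rep-freeRoot _ (A i a) x∉S free = Equivalence.from T-∧ (free , L¹.root-isRoot (∉-restrict⁺ (encode ∘ A i) x∉S))
    rep-freeRoot _ (B i a) x∉S free = Equivalence.from T-∧ (free , L².root-isRoot (∉-restrict⁺ (encode ∘ B i) x∉S))

    distinguishedSurvives : Bool
    distinguishedSurvives = any (λ v → isDist (decodeV v) ∧ not (lookup S v)) (List.allFin n)

    distinguishedSurvives-intro : ∀ x → T (isDist x) → encode x ∉ S → T distinguishedSurvives
    distinguishedSurvives-intro x dx x∉S = any⁺ _ (Any.map survives (∈-allFin (encode x)))
      where
        survives : ∀ {v} → encode x ≡ v → T (isDist (decodeV v) ∧ not (lookup S v))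
        survives refl = Equivalence.from T-∧ (subst (T ∘ isDist) (sym (decode-encode x)) dx , ∉⇒T-not x∉S)

    slot : V → Fin (suc n)
    slot x = if isDist (rep x) then zero else suc (encode (rep x))

    active : Fin (suc n) → Bool
    active zero    = distinguishedSurvives
    active (suc v) = freeRoot (decodeV v)

    slot-active : (∀ t → encode (T' t) ∈ S) → ∀ x → encode x ∉ S → T (active (slot x))
    slot-active T⊆S x x∉S with isDist (rep x) in d
    ... | true  = distinguishedSurvives-intro (rep x) (subst T (sym d) _) (Reach-target (reaches-rep x x∉S))
    ... | false = subst (T ∘ freeRoot) (sym (decode-encode (rep x)))
                        (rep-freeRoot T⊆S x x∉S (subst (T ∘ not) (sym d) _))

    slot-reach : ∀ x y → encode x ∉ S → encode y ∉ S → slot x ≡ slot y → Reach G S (encode x) (encode y)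
    slot-reach x y x∉S y∉S = through (reaches-rep x x∉S) (reaches-rep y y∉S)
      where
        through : Reach G S (encode x) (encode (rep x)) → Reach G S (encode y) (encode (rep y)) →
                  slot x ≡ slot y → Reach G S (encode x) (encode y)
        through rx ry same with isDist (rep x) in dx | isDist (rep y) in dy
        ... | true  | true  =
          Reach-trans rx (Reach-trans (distinguished-Reach (rep x) (rep y) (subst T (sym dx) _) (subst T (sym dy) _)
                                                           (Reach-target rx) (Reach-target ry))
                                      (Reach-sym G''-sym ry))
        ... | false | false =
          Reach-trans rx (subst (λ w → Reach G S w (encode y)) (sym (suc-injective same)) (Reach-sym G''-sym ry))

    freeRootsA freeRootsB deletionsA deletionsB exceptional : ℕ
    freeRootsA  = sum (L¹.freeRoots ∘ deletedA)
    freeRootsB  = sum (L².freeRoots ∘ deletedB)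
    deletionsA  = sum (∣_∣ ∘ deletedA)
    deletionsB  = sum (∣_∣ ∘ deletedB)
    exceptional = sum (iverson ∘ L².terminalSurvives ∘ deletedB)

    count-active : count active ≡ iverson distinguishedSurvives + (freeRootsA + freeRootsB)
    count-active = cong (iverson distinguishedSurvives +_)
      (trans (sum-decode (iverson ∘ freeRoot)) (cong (_+ (freeRootsA + freeRootsB)) (trans (sum-const l 0) (*-zeroʳ l))))

    weighted-A : ∀ p q → p ≤ 2 * q → p * freeRootsA ≤ q * deletionsA
    weighted-A p q p≤2q = sum-scaled-≤ {a = p} {b = q} (L¹.freeRoots ∘ deletedA) (∣_∣ ∘ deletedA)
                            (L¹-weighted-bound p q p≤2q ∘ deletedA)

    weighted-B : ∀ p q → p ≤ 2 * q → 3 * q ≤ 2 * p →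
                 p * freeRootsB + 3 * q * exceptional ≤ q * deletionsB + 2 * p * exceptional
    weighted-B p q p≤2q 3q≤2p = sum-scaled₂-≤ {a = p} {b = 3 * q} {c = q} {d = 2 * p}
      (L².freeRoots ∘ deletedB) (iverson ∘ L².terminalSurvives ∘ deletedB)
      (∣_∣ ∘ deletedB) (iverson ∘ L².terminalSurvives ∘ deletedB)
      (L²-weighted-bound p q p≤2q 3q≤2p ∘ deletedB)

    exceptional≤m₂ : exceptional ≤ m₂
    exceptional≤m₂ = subst (exceptional ≤_) (trans (sum-const m₂ 1) (*-identityʳ m₂))
                           (sum-mono-≤ (iverson≤1 ∘ L².terminalSurvives ∘ deletedB))

    exceptional≡0 : ¬ T distinguishedSurvives → exceptional ≡ 0
    exceptional≡0 none = trans (sum-cong-≗ unexceptional) (trans (sum-const m₂ 0) (*-zeroʳ m₂))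
      where
        unexceptional : ∀ i → iverson (L².terminalSurvives (deletedB i)) ≡ 0
        unexceptional i with L².terminalSurvives (deletedB i) in survives
        ... | false = refl
        ... | true with L².terminalSurvives⇒∃ (subst T (sym survives) _)
        ...   | t , terminal , t∉ =
          ⊥-elim (none (distinguishedSurvives-intro (B i t) terminal (∉-restrict⁻ (encode ∘ B i) t∉)))

    module _ {k} (comp : Components G S k) (1<k : 1 < k) where

      T⊆S : ∀ t → encode (T' t) ∈ S
      T⊆S t = universal∈separator comp 1<k (encode (T' t)) λ v v≢t →
        subst (T ∘ edgeV (decodeV v)) (sym (decode-encode (T' t)))
          (universal-edge (decodeV v) t (λ eq → v≢t (trans (sym (encode-decode v)) (cong encode eq))))

      k≤count-active : k ≤ count active
      k≤count-active = components≤count comp (slot ∘ decodeV) active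
        (λ v v∉S → slot-active T⊆S (decodeV v) (survives v∉S))
        (λ u v u∉S v∉S same → subst₂ (Reach G S) (encode-decode u) (encode-decode v)
                                 (slot-reach (decodeV u) (decodeV v) (survives u∉S) (survives v∉S) same))
        where
          survives : ∀ {v} → v ∉ S → encode (decodeV v) ∉ S
          survives {v} = subst (_∉ S) (sym (encode-decode v))

      ∣S∣≡ : ∣ S ∣ ≡ l + (deletionsA + deletionsB)
      ∣S∣≡ = begin
        ∣ S ∣                                        ≡⟨ ∣∣≡count S ⟩
        count (lookup S)                             ≡⟨ sum-cong-≗ (cong (iverson ∘ lookup S) ∘ sym ∘ encode-decode)
                                                      ⟩
        sum (iverson ∘ lookup S ∘ encode ∘ decodeV)  ≡⟨ sum-decode (iverson ∘ lookup S ∘ encode) ⟩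
        sum (λ t → iverson (lookup S (encode (T' t)))) + (sum (λ i → count (lookup S ∘ encode ∘ A i))
                                                       + sum (λ i → count (lookup S ∘ encode ∘ B i)))
          ≡⟨ cong₂ _+_ T-part (cong₂ _+_ (sum-cong-≗ (λ i → sym (∣restrict∣ (encode ∘ A i))))
                                         (sum-cong-≗ (λ i → sym (∣restrict∣ (encode ∘ B i))))) ⟩
        l + (deletionsA + deletionsB)                ∎
        where
          open ≡-Reasoning
          T-part : sum (λ t → iverson (lookup S (encode (T' t)))) ≡ l
          T-part = trans (sum-cong-≗ (cong iverson ∘ []=⇒lookup ∘ T⊆S)) (trans (sum-const l 1) (*-identityʳ l))
          ∣restrict∣ : ∀ {k} (f : Fin k → Fin n) → ∣ restrict S f ∣ ≡ count (lookup S ∘ f)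
          ∣restrict∣ f = trans (∣∣≡count (restrict S f)) (sum-cong-≗ (cong iverson ∘ lookup∘tabulate (lookup S ∘ f)))

  lowerBound : 2 ≤ l → l ≤ m₂ + 2 → ∀ (S : Subset (order l m₁ m₂)) k → Components G S k → 1 < k →
               (l + 3 * m₂) * k ≤ ∣ S ∣ * (2 * m₂ + 1)
  lowerBound 2≤l l≤m₂+2 S k comp 1<k = begin
    p * k                                                            ≤⟨ *-monoʳ-≤ p (k≤count-active comp 1<k) ⟩
    p * count active                                                 ≡⟨ cong (p *_) count-active ⟩
    p * (iverson distinguishedSurvives + (freeRootsA + freeRootsB))  ≤⟨ bound distinguishedSurvives exceptional≡0 ⟩
    (l + (deletionsA + deletionsB)) * q                              ≡⟨ cong (_* q) (sym (∣S∣≡ comp 1<k)) ⟩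
    ∣ S ∣ * q                                                        ∎
    where
      open LowerBound S
      open ≤-Reasoning
      p = l + 3 * m₂
      q = 2 * m₂ + 1
      p≤2q′  = p≤2q l m₂ l≤m₂+2
      3q≤2p′ = 3q≤2p l m₂ 2≤l
      bound : ∀ b → (¬ T b → exceptional ≡ 0) →
              p * (iverson b + (freeRootsA + freeRootsB)) ≤ (l + (deletionsA + deletionsB)) * q
      bound true  _    = bound-with-hub p q l (exceptional-copies l m₂ exceptional 2≤l exceptional≤m₂)
                                        (weighted-A p q p≤2q′) (weighted-B p q p≤2q′ 3q≤2p′)
      bound false none = bound-without-hub p q l (none id) (weighted-A p q p≤2q′) (weighted-B p q p≤2q′ 3q≤2p′)

  A-alone : ∀ {del : V → Bool} i a → isXY (toℕ a) ≡ false → (∀ t → del (T' t) ≡ true) →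
            L¹.NeighboursIn (λ b → del (A i b)) a → ∀ y → del y ≡ false → ¬ T (edgeV (A i a) y)
  A-alone i a inner T-del nbrs (T' t) y-kept _ with trans (sym (T-del t)) y-kept
  ... | ()
  A-alone i a inner T-del nbrs (B _ _) y-kept e rewrite inner = e
  A-alone i a inner T-del nbrs (A i′ b) y-kept e rewrite inner with toℕ i ≡ᵇ toℕ i′ in same-copy
  ... | false = e
  ... | true with toℕ-injective (≡ᵇ⇒≡ (toℕ i) (toℕ i′) (subst T (sym same-copy) _))
  ...   | refl = subst T y-kept (nbrs b (proj₂ (Equivalence.to (T-∧ {not (toℕ a ≡ᵇ toℕ b)}) e)))

  B-alone : ∀ {del : V → Bool} i a → isXY (toℕ a) ≡ false → (∀ t → del (T' t) ≡ true) →
            L².NeighboursIn (λ b → del (B i b)) a → ∀ y → del y ≡ false → ¬ T (edgeV (B i a) y)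
  B-alone i a inner T-del nbrs (T' t) y-kept _ with trans (sym (T-del t)) y-kept
  ... | ()
  B-alone i a inner T-del nbrs (A _ _) y-kept e rewrite inner = e
  B-alone i a inner T-del nbrs (B i′ b) y-kept e rewrite inner with toℕ i ≡ᵇ toℕ i′ in same-copy
  ... | false = e
  ... | true with toℕ-injective (≡ᵇ⇒≡ (toℕ i) (toℕ i′) (subst T (sym same-copy) _))
  ...   | refl = subst T y-kept (nbrs b (proj₂ (Equivalence.to (T-∧ {not (toℕ a ≡ᵇ toℕ b)}) e)))

  module Cut (del : V → Bool) where

    S : Subset (order l m₁ m₂)
    S = Vec.tabulate (del ∘ decode l m₁ m₂)

    lookup-S : ∀ x → lookup S (encode x) ≡ del x
    lookup-S x = trans (lookup∘tabulate (del ∘ decode l m₁ m₂) (encode x)) (cong del (decode-encode x))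

    kept : ∀ x → del x ≡ false → encode x ∉ S
    kept x del≡false = T-not⇒∉ (subst (T ∘ not) (sym (trans (lookup-S x) del≡false)) _)

    kept⁻ : ∀ {v} → v ∉ S → del (decode l m₁ m₂ v) ≡ false
    kept⁻ {v} v∉S with del (decode l m₁ m₂ v) in eq
    ... | false = refl
    ... | true  = ⊥-elim (v∉S (lookup⇒[]= v S (trans (lookup∘tabulate _ v) eq)))

    hubAndIsolated :
      ∀ {N} (isolated : Fin N → V) (index : V → Maybe (Fin N)) →
      (∀ i → index (isolated i) ≡ just i) → (∀ x {i} → index x ≡ just i → x ≡ isolated i) →
      (∀ i → del (isolated i) ≡ false) → (∀ i y → del y ≡ false → ¬ T (edgeV (isolated i) y)) →
      ∀ hub → del hub ≡ false → index hub ≡ nothing →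
      (∀ x → del x ≡ false → index x ≡ nothing → Reach G S (encode hub) (encode x)) →
      Components G S (suc N)
    hubAndIsolated isolated index index-isolated index⇒isolated isolated-kept isolated-alone
                   hub hub-kept index-hub hub-reach =
      hubAndIsolated-components G''-sym (encode ∘ isolated) (index ∘ decode l m₁ m₂)
        (λ i → trans (cong index (decode-encode (isolated i))) (index-isolated i))
        (λ v eq → trans (sym (encode-decode v)) (cong encode (index⇒isolated _ eq)))
        (λ i → kept (isolated i) (isolated-kept i))
        (λ i v v∉S e → isolated-alone i _ (kept⁻ v∉S)
                                       (subst (λ x → T (edgeV x _)) (decode-encode (isolated i)) e))
        (encode hub) (kept hub hub-kept) (trans (cong index (decode-encode hub)) index-hub)
        (λ v v∉S eq → subst (Reach G S (encode hub)) (encode-decode v) (hub-reach _ (kept⁻ v∉S) eq))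

    ∣S∣≡ : ∣ S ∣ ≡ sum (λ t → iverson (del (T' t))) + (sum (λ i → count (del ∘ A i))
                                                    + sum (λ i → count (del ∘ B i)))
    ∣S∣≡ = trans (∣∣≡count S) (trans (sum-cong-≗ (cong iverson ∘ lookup∘tabulate (del ∘ decode l m₁ m₂)))
                                      (sum-decode (iverson ∘ del)))

  module CutL²Copies (b₀ : Fin m₂) where

    del : V → Bool
    del (T' _)  = true
    del (A _ _) = false
    del (B _ j) = evenW j

    open Cut del public

    isolated : Fin (m₂ + m₂) → V
    isolated = [ (λ i → B i 2F) , (λ i → B i 6F) ]′ ∘ splitAt m₂

    index : V → Maybe (Fin (m₂ + m₂))
    index (B i 2F) = just (i ↑ˡ m₂)
    index (B i 6F) = just (m₂ ↑ʳ i)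
    index _        = nothing

    index-isolated : ∀ c → index (isolated c) ≡ just c
    index-isolated c with splitAt m₂ c in split
    ... | inj₁ i = cong just (splitAt⇒join m₂ split)
    ... | inj₂ i = cong just (splitAt⇒join m₂ split)

    index⇒isolated : ∀ x {c} → index x ≡ just c → x ≡ isolated c
    index⇒isolated (B i 2F) refl rewrite splitAt-↑ˡ m₂ i m₂ = refl
    index⇒isolated (B i 6F) refl rewrite splitAt-↑ʳ m₂ m₂ i = refl
    index⇒isolated (T' _)   ()
    index⇒isolated (A _ _)  ()
    index⇒isolated (B _ 0F) ()
    index⇒isolated (B _ 1F) ()
    index⇒isolated (B _ 3F) ()
    index⇒isolated (B _ 4F) ()
    index⇒isolated (B _ 5F) ()

    isolated-kept : ∀ c → del (isolated c) ≡ false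
    isolated-kept c with splitAt m₂ c
    ... | inj₁ _ = refl
    ... | inj₂ _ = refl

    isolated-alone : ∀ c y → del y ≡ false → ¬ T (edgeV (isolated c) y)
    isolated-alone c with splitAt m₂ c
    ... | inj₁ i = B-alone i 2F refl (λ _ → refl) L²-w₃-neighbours-even
    ... | inj₂ i = B-alone i 6F refl (λ _ → refl) L²-w₇-neighbours-even

    hub-reach : ∀ x → del x ≡ false → index x ≡ nothing → Reach G S (encode (B b₀ 0F)) (encode x)
    hub-reach (A i j)  _ _ =
      Reach-trans (distinguished-Reach (B b₀ 0F) (A i 0F) _ _ (kept (B b₀ 0F) refl) (kept (A i 0F) refl))
                  (A-Reach i (λ {a} _ → kept (A i a) refl) (L¹-connected-from-x j))
    hub-reach (B i 0F) _ _ = distinguished-Reach (B b₀ 0F) (B i 0F) _ _ (kept (B b₀ 0F) refl) (kept (B i 0F) refl)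
    hub-reach (B i 4F) _ _ = distinguished-Reach (B b₀ 0F) (B i 4F) _ _ (kept (B b₀ 0F) refl) (kept (B i 4F) refl)
    hub-reach (T' _)   () _
    hub-reach (B _ 1F) () _
    hub-reach (B _ 2F) _ ()
    hub-reach (B _ 3F) () _
    hub-reach (B _ 5F) () _
    hub-reach (B _ 6F) _ ()

    components : Components G S (suc (m₂ + m₂))
    components = hubAndIsolated isolated index index-isolated index⇒isolated isolated-kept isolated-alone
                                (B b₀ 0F) refl refl hub-reach

    size : ∣ S ∣ ≡ l * 1 + (m₁ * 0 + m₂ * 3)
    size = trans ∣S∣≡ (cong₂ _+_ (sum-const l 1) (cong₂ _+_ (sum-const m₁ 0) (sum-const m₂ 3)))

  module CutL¹Copies (a₀ : Fin m₁) where

    del : V → Bool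
    del (T' _)  = true
    del (A _ j) = evenW j
    del (B _ _) = false

    open Cut del public

    isolated : Fin (m₁ + m₁) → V
    isolated = [ (λ i → A i 2F) , (λ i → A i 6F) ]′ ∘ splitAt m₁

    index : V → Maybe (Fin (m₁ + m₁))
    index (A i 2F) = just (i ↑ˡ m₁)
    index (A i 6F) = just (m₁ ↑ʳ i)
    index _        = nothing

    index-isolated : ∀ c → index (isolated c) ≡ just c
    index-isolated c with splitAt m₁ c in split
    ... | inj₁ i = cong just (splitAt⇒join m₁ split)
    ... | inj₂ i = cong just (splitAt⇒join m₁ split)

    index⇒isolated : ∀ x {c} → index x ≡ just c → x ≡ isolated c
    index⇒isolated (A i 2F) refl rewrite splitAt-↑ˡ m₁ i m₁ = refl
    index⇒isolated (A i 6F) refl rewrite splitAt-↑ʳ m₁ m₁ i = refl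
    index⇒isolated (T' _)   ()
    index⇒isolated (B _ _)  ()
    index⇒isolated (A _ 0F) ()
    index⇒isolated (A _ 1F) ()
    index⇒isolated (A _ 3F) ()
    index⇒isolated (A _ 4F) ()
    index⇒isolated (A _ 5F) ()
    index⇒isolated (A _ 7F) ()

    isolated-kept : ∀ c → del (isolated c) ≡ false
    isolated-kept c with splitAt m₁ c
    ... | inj₁ _ = refl
    ... | inj₂ _ = refl

    isolated-alone : ∀ c y → del y ≡ false → ¬ T (edgeV (isolated c) y)
    isolated-alone c with splitAt m₁ c
    ... | inj₁ i = A-alone i 2F refl (λ _ → refl) L¹-w₃-neighbours-even
    ... | inj₂ i = A-alone i 6F refl (λ _ → refl) L¹-w₇-neighbours-even

    hub-reach : ∀ x → del x ≡ false → index x ≡ nothing → Reach G S (encode (A a₀ 0F)) (encode x)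
    hub-reach (B i j)  _ _ =
      Reach-trans (distinguished-Reach (A a₀ 0F) (B i 0F) _ _ (kept (A a₀ 0F) refl) (kept (B i 0F) refl))
                  (B-Reach i (λ {b} _ → kept (B i b) refl) (L²-connected-from-x j))
    hub-reach (A i 0F) _ _ = distinguished-Reach (A a₀ 0F) (A i 0F) _ _ (kept (A a₀ 0F) refl) (kept (A i 0F) refl)
    hub-reach (A i 4F) _ _ = distinguished-Reach (A a₀ 0F) (A i 4F) _ _ (kept (A a₀ 0F) refl) (kept (A i 4F) refl)
    hub-reach (T' _)   () _
    hub-reach (A _ 1F) () _
    hub-reach (A _ 2F) _ ()
    hub-reach (A _ 3F) () _
    hub-reach (A _ 5F) () _
    hub-reach (A _ 6F) _ ()
    hub-reach (A _ 7F) () _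

    components : Components G S (suc (m₁ + m₁))
    components = hubAndIsolated isolated index index-isolated index⇒isolated isolated-kept isolated-alone
                                (A a₀ 0F) refl refl hub-reach

    size : ∣ S ∣ ≡ l * 1 + (m₁ * 4 + m₂ * 0)
    size = trans ∣S∣≡ (cong₂ _+_ (sum-const l 1) (cong₂ _+_ (sum-const m₁ 4) (sum-const m₂ 0)))

-- Of the hypothesis 2l + 1 ≤ m₁ + m₂ only m₁ > 0 in the case m₂ = 0 is needed.
claim5 : (l m₁ m₂ : ℕ) → 2 ≤ l → 2 * l + 1 ≤ m₁ + m₂ → l ≤ m₂ + 2 →
    ToughnessEq (G'' l m₁ m₂) (l + 3 * m₂) (2 * m₂ + 1)
claim5 l m₁ (suc m) 2≤l _ l≤m₂+2 =
  lowerBound 2≤l l≤m₂+2 , S , suc (suc m + suc m) , components , s≤s (s≤s z≤n) , ratio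
  where
    open CutL²Copies {l} {m₁} {suc m} zero
    ratio : ∣ S ∣ * (2 * suc m + 1) ≡ (l + 3 * suc m) * suc (suc m + suc m)
    ratio = trans (cong (_* (2 * suc m + 1)) size) (solve (l ∷ m₁ ∷ m ∷ []))
claim5 (suc zero)          _       zero (s≤s ()) _ _
claim5 (suc (suc (suc _))) _       zero _ _ (s≤s (s≤s ()))
claim5 2                   zero    zero _ () _
claim5 2                   (suc m) zero 2≤l _ l≤2 =
  lowerBound 2≤l l≤2 , S , suc (suc m + suc m) , components , s≤s (s≤s z≤n) , ratio
  where
    open CutL¹Copies {2} {suc m} {0} zero
    ratio : ∣ S ∣ * (2 * 0 + 1) ≡ (2 + 3 * 0) * suc (suc m + suc m)
    ratio = trans (cong (_* 1) size) (solve (m ∷ []))
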